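{- Let $n\ge 1$ and let $G$ be a connected proper subgraph of the $n$-cube $Q_n$ having $2^n$ vertices (equivalently, a connected spanning subgraph of $Q_n$ with fewer edges than $Q_n$). Then, for every ordering of the vertices of $G$, the adjacency matrix $A(G)$ is not diagonalizable by the standard Hadamard matrix $H_n$, i.e. there is no diagonal matrix $\Lambda$ with $A(G)=\frac{1}{2^n}H_n\Lambda H_n^T$.
   Context: All graphs are simple and undirected. The $n$-cube $Q_n$ is the graph whose vertices are the binary strings of length $n$, two strings being adjacent iff they differ in exactly one position. The adjacency matrix $A(G)$ of a graph on vertices $1,\dots,m$ is the $m\times m$ $0/1$ matrix with $(j,k)$ entry $1$ iff $j$ and $k$ are adjacent. The standard Hadamard matrices are $H_1=\begin{bmatrix}1&1\\1&-1\end{bmatrix}$ and $H_n=H_1\otimes H_{n-1}=H_1^{\otimes n}$ (Kronecker product), a $2^n\times 2^n$ matrix.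
   Formalization: The diagonal matrix Λ has its entries taken in the rationals. -}

module Defs where

open import Data.Nat as ℕ using (ℕ; zero; suc; _^_)
open import Data.Nat.Properties using (m^n≢0)
open import Data.Bool using (Bool; true; false; if_then_else_)
open import Data.Fin as Fin using (Fin; remQuot)
open import Data.Vec using (Vec; []; _∷_)
open import Data.Product using (_×_; _,_; ∃; Σ)
open import Data.Integer using (+_; -_)
open import Data.Rational as ℚ using (ℚ; 0ℚ; 1ℚ)
open import Relation.Binary.PropositionalEquality using (_≡_)
open import Relation.Nullary using (¬_)
open import Function.Bundles using (_⤖_)

Matrix : ℕ → ℕ → Set
Matrix m k = Fin m → Fin k → ℚ

∑ : (m : ℕ) → (Fin m → ℚ) → ℚ
∑ zero    f = 0ℚ
∑ (suc m) f = f Fin.zero ℚ.+ ∑ m (λ i → f (Fin.suc i))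

_⊗_ : ∀ {m k p q} → Matrix m k → Matrix p q → Matrix (m ℕ.* p) (k ℕ.* q)
_⊗_ {p = p} {q = q} A B i j with remQuot p i | remQuot q j
... | (i₁ , i₂) | (j₁ , j₂) = A i₁ j₁ ℚ.* B i₂ j₂

_·_ : ∀ {m k p} → Matrix m k → Matrix k p → Matrix m p
_·_ {k = k} A B i j = ∑ k (λ l → A i l ℚ.* B l j)

transpose : ∀ {m k} → Matrix m k → Matrix k m
transpose A i j = A j i

diag : ∀ {m} → (Fin m → ℚ) → Matrix m m
diag d i j with i Fin.≟ j
... | Relation.Nullary.yes _ = d i
... | Relation.Nullary.no  _ = 0ℚ

scale : ∀ {m k} → ℚ → Matrix m k → Matrix m k
scale c A i j = c ℚ.* A i j

H₁ : Matrix 2 2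
H₁ Fin.zero    Fin.zero    = 1ℚ
H₁ Fin.zero    (Fin.suc _) = 1ℚ
H₁ (Fin.suc _) Fin.zero    = 1ℚ
H₁ (Fin.suc _) (Fin.suc _) = ℚ.- 1ℚ

H : (n : ℕ) → Matrix (2 ^ n) (2 ^ n)
H zero    _ _ = 1ℚ
H (suc n) = H₁ ⊗ H n

inv2^ : ℕ → ℚ
inv2^ n = (+ 1 ℚ./ (2 ^ n)) {{m^n≢0 2 n}}

Vertex : ℕ → Set
Vertex n = Vec Bool n

data Adj1 : ∀ {n} → Vertex n → Vertex n → Set where
  here  : ∀ {n b c} {u : Vertex n} → ¬ (b ≡ c) → Adj1 (b ∷ u) (c ∷ u)
  there : ∀ {n b} {u v : Vertex n} → Adj1 u v → Adj1 (b ∷ u) (b ∷ v)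

Graph : ℕ → Set
Graph n = Vertex n → Vertex n → Bool

Edge : ∀ {n} → Graph n → Vertex n → Vertex n → Set
Edge G u v = G u v ≡ true

IsSimple : ∀ {n} → Graph n → Set
IsSimple G = (∀ u v → G u v ≡ G v u) × (∀ u → G u u ≡ false)

IsSubgraphOfCube : ∀ {n} → Graph n → Set
IsSubgraphOfCube G = ∀ u v → Edge G u v → Adj1 u v

MissesCubeEdge : ∀ {n} → Graph n → Set
MissesCubeEdge G = ∃ λ u → ∃ λ v → Adj1 u v × G u v ≡ false

data Reachable {n} (G : Graph n) : Vertex n → Vertex n → Set where
  refl : ∀ {u} → Reachable G u u
  step : ∀ {u v w} → Edge G u v → Reachable G v w → Reachable G u w

Connected : ∀ {n} → Graph n → Set
Connected G = ∀ u v → Reachable G u v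

adjMatrix : ∀ {n} → Graph n → (Fin (2 ^ n) ⤖ Vertex n) → Matrix (2 ^ n) (2 ^ n)
adjMatrix G σ j k = if G (to j) (to k) then 1ℚ else 0ℚ
  where open Function.Bundles.Bijection σ using (to)

HadamardDiagonalizable : (n : ℕ) → Matrix (2 ^ n) (2 ^ n) → Set
HadamardDiagonalizable n A =
  Σ (Fin (2 ^ n) → ℚ) λ d →
    ∀ j k → A j k ≡ scale (inv2^ n) ((H n · diag d) · transpose (H n)) j k

module Submission where

-- Label the vertices by ℤ₂ⁿ = Vec Bool n via the ordering and the binary
-- expansion of indices.  The (j, l) entry of Hₙ is the character (-1)^⟨j,l⟩,
-- so the (j, k) entry of (1/2ⁿ) Hₙ Λ Hₙᵀ depends only on j ⊕ k.  Hence if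
-- A(G) = (1/2ⁿ) Hₙ Λ Hₙᵀ, G is the Cayley graph of ℤ₂ⁿ with connection set
-- S = {s | 0 ~ s}, and two counts of S contradict each other:
--   * every vertex has |S| neighbours, while an endpoint u of a cube edge uv
--     missing from G has at most n - 1 of them, so |S| < n;
--   * each step of a path adds an element of S, so by connectivity the span
--     of S (at most 2^|S| vectors) is all of ℤ₂ⁿ, so n ≤ |S|.

open import Defs
open import Data.Nat as ℕ using (ℕ; zero; suc; _^_; _≤_; _<_; _≥_; z≤n; s≤s)
import Data.Nat.Properties as ℕP
open import Data.Bool as Bool using (Bool; true; false; _xor_; _∧_; not; if_then_else_)
open import Data.Bool.Properties
  using (xor-assoc; xor-comm; xor-identityˡ; xor-same; ∧-distribʳ-xor; xor-∧-commutativeRing; ¬-not)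
open import Data.Fin as Fin using (Fin; remQuot; quotient; remainder; combine)
open import Data.Fin.Properties using (remQuot-combine; combine-remQuot; suc-injective; injective⇒≤; 2↔Bool)
open import Data.Vec using (Vec; []; _∷_; zipWith; replicate)
open import Data.Vec.Properties using (zipWith-assoc; zipWith-comm; zipWith-identityˡ)
open import Data.List using (List; []; _∷_; _++_; map; length; filter; tabulate; lookup)
open import Data.List.Properties using (length-map; length-++; length-tabulate)
open import Data.List.Membership.Propositional using (_∈_)
open import Data.List.Membership.Propositional.Properties
  using (∈-map⁺; ∈-map⁻; ∈-++⁺ˡ; ∈-++⁺ʳ; ∈-++⁻; ∈-filter⁺; ∈-filter⁻; ∈-tabulate⁺; ∈-lookup)
open import Data.List.Relation.Binary.Subset.Propositional using (_⊆_)
open import Data.List.Relation.Unary.Any using (here; there; index)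
open import Data.List.Relation.Unary.Any.Properties using (lookup-index)
open import Data.List.Relation.Unary.All as All using (All)
open import Data.List.Relation.Unary.AllPairs using (_∷_)
open import Data.List.Relation.Unary.Unique.Propositional using (Unique)
import Data.List.Relation.Unary.Unique.Propositional.Properties as Unique
open import Data.Rational as ℚ using (ℚ; 0ℚ; 1ℚ)
import Data.Rational.Properties as ℚP
open import Data.Product using (_×_; _,_; ∃; proj₁; proj₂)
open import Data.Sum using (_⊎_; inj₁; inj₂)
open import Data.Empty using (⊥-elim)
open import Algebra.Bundles using (CommutativeRing; CommutativeMonoid)
open import Relation.Binary.PropositionalEquality
open import Relation.Nullary using (¬_; yes; no)
open import Function using (_∘_)
open import Function.Bundles using (_⤖_; module Bijection; module Surjection; module Inverse)
open ≡-Reasoning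

-- The group ℤ₂ⁿ

_⊕_ : ∀ {n} → Vec Bool n → Vec Bool n → Vec Bool n
_⊕_ = zipWith _xor_

infixl 6 _⊕_

0ᵥ : ∀ {n} → Vec Bool n
0ᵥ = replicate _ false

⊕-assoc : ∀ {n} (x y z : Vec Bool n) → (x ⊕ y) ⊕ z ≡ x ⊕ (y ⊕ z)
⊕-assoc = zipWith-assoc xor-assoc

⊕-comm : ∀ {n} (x y : Vec Bool n) → x ⊕ y ≡ y ⊕ x
⊕-comm = zipWith-comm xor-comm

⊕-identityˡ : ∀ {n} (x : Vec Bool n) → 0ᵥ ⊕ x ≡ x
⊕-identityˡ = zipWith-identityˡ xor-identityˡ

⊕-self : ∀ {n} (x : Vec Bool n) → x ⊕ x ≡ 0ᵥ
⊕-self []      = refl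
⊕-self (a ∷ x) = cong₂ _∷_ (xor-same a) (⊕-self x)

⊕-cancelˡ : ∀ {n} (x y : Vec Bool n) → x ⊕ (x ⊕ y) ≡ y
⊕-cancelˡ x y = begin
  x ⊕ (x ⊕ y)  ≡⟨ ⊕-assoc x x y ⟨
  (x ⊕ x) ⊕ y  ≡⟨ cong (_⊕ y) (⊕-self x) ⟩
  0ᵥ ⊕ y       ≡⟨ ⊕-identityˡ y ⟩
  y            ∎

⊕-cancelʳ : ∀ {n} (x y : Vec Bool n) → (x ⊕ y) ⊕ x ≡ y
⊕-cancelʳ x y = trans (⊕-comm (x ⊕ y) x) (⊕-cancelˡ x y)

⊕-injectiveˡ : ∀ {n} (x : Vec Bool n) {y z} → x ⊕ y ≡ x ⊕ z → y ≡ z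
⊕-injectiveˡ x {y} {z} e = trans (sym (⊕-cancelˡ x y)) (trans (cong (x ⊕_) e) (⊕-cancelˡ x z))

⊕-left-comm : ∀ {n} (s t y : Vec Bool n) → s ⊕ (t ⊕ y) ≡ t ⊕ (s ⊕ y)
⊕-left-comm s t y = begin
  s ⊕ (t ⊕ y)  ≡⟨ ⊕-assoc s t y ⟨
  s ⊕ t ⊕ y    ≡⟨ cong (_⊕ y) (⊕-comm s t) ⟩
  t ⊕ s ⊕ y    ≡⟨ ⊕-assoc t s y ⟩
  t ⊕ (s ⊕ y)  ∎

dot : ∀ {n} → Vec Bool n → Vec Bool n → Bool
dot []      []      = false
dot (a ∷ x) (b ∷ y) = (a ∧ b) xor dot x y

dot-⊕ : ∀ {n} (x y z : Vec Bool n) → dot (x ⊕ y) z ≡ dot x z xor dot y z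
dot-⊕ []      []      []      = refl
dot-⊕ (a ∷ x) (b ∷ y) (c ∷ z) = begin
  ((a xor b) ∧ c) xor dot (x ⊕ y) z
    ≡⟨ cong₂ _xor_ (∧-distribʳ-xor c a b) (dot-⊕ x y z) ⟩
  ((a ∧ c) xor (b ∧ c)) xor (dot x z xor dot y z)
    ≡⟨ interchange (a ∧ c) (b ∧ c) (dot x z) (dot y z) ⟩
  ((a ∧ c) xor dot x z) xor ((b ∧ c) xor dot y z)  ∎
  where
  open import Algebra.Properties.CommutativeSemigroup
    (CommutativeRing.+-commutativeSemigroup xor-∧-commutativeRing) using (interchange)

χ : Bool → ℚ
χ false = 1ℚ
χ true  = ℚ.- 1ℚ

χ-xor : ∀ a b → χ a ℚ.* χ b ≡ χ (a xor b)
χ-xor false false = refl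
χ-xor false true  = refl
χ-xor true  false = refl
χ-xor true  true  = refl

-- Binary expansion of indices: Fin (2 ^ n) ≅ ℤ₂ⁿ, most significant bit
-- first, matching the recursion Hₙ₊₁ = H₁ ⊗ Hₙ.

open Inverse 2↔Bool using () renaming (to to bit; from to fromBit;
  strictlyInverseˡ to bit-fromBit; strictlyInverseʳ to fromBit-bit)

bits : (n : ℕ) → Fin (2 ^ n) → Vec Bool n
bits zero    _ = []
bits (suc n) i = bit (quotient (2 ^ n) i) ∷ bits n (remainder {2} (2 ^ n) i)

unbits : (n : ℕ) → Vec Bool n → Fin (2 ^ n)
unbits zero    []      = Fin.zero
unbits (suc n) (a ∷ x) = combine (fromBit a) (unbits n x)

bits-unbits : ∀ n x → bits n (unbits n x) ≡ x
bits-unbits zero    []      = refl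
bits-unbits (suc n) (a ∷ x) = cong₂ _∷_
  (trans (cong (bit ∘ proj₁) split) (bit-fromBit a))
  (trans (cong (bits n ∘ proj₂) split) (bits-unbits n x))
  where split = remQuot-combine {2} {2 ^ n} (fromBit a) (unbits n x)

unbits-bits : ∀ n i → unbits n (bits n i) ≡ i
unbits-bits zero    Fin.zero = refl
unbits-bits (suc n) i = trans
  (cong₂ combine (fromBit-bit (quotient (2 ^ n) i)) (unbits-bits n (remainder {2} (2 ^ n) i)))
  (combine-remQuot {2} (2 ^ n) i)

bits-injective : ∀ n {i j} → bits n i ≡ bits n j → i ≡ j
bits-injective n {i} {j} e = trans (sym (unbits-bits n i)) (trans (cong (unbits n) e) (unbits-bits n j))

allVectors : (n : ℕ) → List (Vec Bool n)
allVectors n = tabulate (bits n)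

allVectors-length : ∀ n → length (allVectors n) ≡ 2 ^ n
allVectors-length n = length-tabulate (bits n)

allVectors-unique : ∀ n → Unique (allVectors n)
allVectors-unique n = Unique.tabulate⁺ (bits-injective n)

∈-allVectors : ∀ {n} (x : Vec Bool n) → x ∈ allVectors n
∈-allVectors {n} x = subst (_∈ allVectors n) (bits-unbits n x) (∈-tabulate⁺ (unbits n x))

∑-cong : ∀ m {f g : Fin m → ℚ} → (∀ i → f i ≡ g i) → ∑ m f ≡ ∑ m g
∑-cong zero    eq = refl
∑-cong (suc m) eq = cong₂ ℚ._+_ (eq Fin.zero) (∑-cong m (eq ∘ Fin.suc))

∑-zero : ∀ m {f : Fin m → ℚ} → (∀ i → f i ≡ 0ℚ) → ∑ m f ≡ 0ℚ
∑-zero zero    eq = refl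
∑-zero (suc m) eq = cong₂ ℚ._+_ (eq Fin.zero) (∑-zero m (eq ∘ Fin.suc))

∑-single : ∀ m (l : Fin m) (f : Fin m → ℚ) → (∀ i → ¬ i ≡ l → f i ≡ 0ℚ) → ∑ m f ≡ f l
∑-single (suc m) Fin.zero f off = trans
  (cong (f Fin.zero ℚ.+_) (∑-zero m (λ i → off (Fin.suc i) λ ())))
  (ℚP.+-identityʳ (f Fin.zero))
∑-single (suc m) (Fin.suc l) f off = trans
  (cong₂ ℚ._+_ (off Fin.zero λ ())
    (∑-single m l (f ∘ Fin.suc) (λ i i≢l → off (Fin.suc i) (i≢l ∘ suc-injective))))
  (ℚP.+-identityˡ (f (Fin.suc l)))

diag-on : ∀ {m} (d : Fin m → ℚ) l → diag d l l ≡ d l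
diag-on d l with l Fin.≟ l
... | yes _   = refl
... | no l≢l = ⊥-elim (l≢l refl)

diag-off : ∀ {m} (d : Fin m → ℚ) i l → ¬ i ≡ l → diag d i l ≡ 0ℚ
diag-off d i l i≢l with i Fin.≟ l
... | yes i≡l = ⊥-elim (i≢l i≡l)
... | no _    = refl

·-diag : ∀ {m k} (A : Matrix m k) (d : Fin k → ℚ) j l → (A · diag d) j l ≡ A j l ℚ.* d l
·-diag {k = k} A d j l = trans
  (∑-single k l (λ i → A j i ℚ.* diag d i l)
    (λ i i≢l → trans (cong (A j i ℚ.*_) (diag-off d i l i≢l)) (ℚP.*-zeroʳ (A j i))))
  (cong (A j l ℚ.*_) (diag-on d l))

-- The entries of Hₙ and of Hₙ Λ Hₙᵀ

H₁-entry : ∀ b c → H₁ b c ≡ χ (bit b ∧ bit c)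
H₁-entry Fin.zero           Fin.zero           = refl
H₁-entry Fin.zero           (Fin.suc Fin.zero) = refl
H₁-entry (Fin.suc Fin.zero) Fin.zero           = refl
H₁-entry (Fin.suc Fin.zero) (Fin.suc Fin.zero) = refl

⊗-entry : ∀ {m k p q} (A : Matrix m k) (B : Matrix p q) i j →
  (A ⊗ B) i j ≡ A (quotient p i) (quotient q j) ℚ.* B (remainder {m} p i) (remainder {k} q j)
⊗-entry {m} {k} {p} {q} A B i j with remQuot {m} p i | remQuot {k} q j
... | _ | _ = refl

H-entry : ∀ n j l → H n j l ≡ χ (dot (bits n j) (bits n l))
H-entry zero    j l = refl
H-entry (suc n) j l = begin
  H (suc n) j l
    ≡⟨ ⊗-entry H₁ (H n) j l ⟩
  H₁ b c ℚ.* H n j′ l′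
    ≡⟨ cong₂ ℚ._*_ (H₁-entry b c) (H-entry n j′ l′) ⟩
  χ (bit b ∧ bit c) ℚ.* χ (dot (bits n j′) (bits n l′))
    ≡⟨ χ-xor (bit b ∧ bit c) (dot (bits n j′) (bits n l′)) ⟩
  χ (dot (bits (suc n) j) (bits (suc n) l))  ∎
  where
  b c : Fin 2
  b = quotient (2 ^ n) j
  c = quotient (2 ^ n) l
  j′ l′ : Fin (2 ^ n)
  j′ = remainder {2} (2 ^ n) j
  l′ = remainder {2} (2 ^ n) l

H-row-product : ∀ n j k l → H n j l ℚ.* H n k l ≡ χ (dot (bits n j ⊕ bits n k) (bits n l))
H-row-product n j k l = begin
  H n j l ℚ.* H n k l
    ≡⟨ cong₂ ℚ._*_ (H-entry n j l) (H-entry n k l) ⟩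
  χ (dot (bits n j) (bits n l)) ℚ.* χ (dot (bits n k) (bits n l))
    ≡⟨ χ-xor (dot (bits n j) (bits n l)) (dot (bits n k) (bits n l)) ⟩
  χ (dot (bits n j) (bits n l) xor dot (bits n k) (bits n l))
    ≡⟨ cong χ (dot-⊕ (bits n j) (bits n k) (bits n l)) ⟨
  χ (dot (bits n j ⊕ bits n k) (bits n l))  ∎

walsh : (n : ℕ) → (Fin (2 ^ n) → ℚ) → Vec Bool n → ℚ
walsh n d x = inv2^ n ℚ.* ∑ (2 ^ n) (λ l → d l ℚ.* χ (dot x (bits n l)))

hadamard-conjugate : ∀ n (d : Fin (2 ^ n) → ℚ) j k →
  scale (inv2^ n) ((H n · diag d) · transpose (H n)) j k ≡ walsh n d (bits n j ⊕ bits n k)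
hadamard-conjugate n d j k = cong (inv2^ n ℚ.*_) (∑-cong (2 ^ n) term)
  where
  open import Algebra.Properties.CommutativeSemigroup
    (CommutativeMonoid.commutativeSemigroup ℚP.*-1-commutativeMonoid) using (xy∙z≈y∙xz)
  term : ∀ l → (H n · diag d) j l ℚ.* H n k l ≡ d l ℚ.* χ (dot (bits n j ⊕ bits n k) (bits n l))
  term l = begin
    (H n · diag d) j l ℚ.* H n k l   ≡⟨ cong (ℚ._* H n k l) (·-diag (H n) d j l) ⟩
    H n j l ℚ.* d l ℚ.* H n k l      ≡⟨ xy∙z≈y∙xz (H n j l) (d l) (H n k l) ⟩
    d l ℚ.* (H n j l ℚ.* H n k l)    ≡⟨ cong (d l ℚ.*_) (H-row-product n j k l) ⟩
    d l ℚ.* χ (dot (bits n j ⊕ bits n k) (bits n l))  ∎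

diagonalizable⇒translation-invariant : ∀ n (A : Matrix (2 ^ n) (2 ^ n)) →
  HadamardDiagonalizable n A → ∀ j k j′ k′ → bits n j ⊕ bits n k ≡ bits n j′ ⊕ bits n k′ → A j k ≡ A j′ k′
diagonalizable⇒translation-invariant n A (d , A≡) j k j′ k′ e = begin
  A j k                            ≡⟨ A≡ j k ⟩
  _                                ≡⟨ hadamard-conjugate n d j k ⟩
  walsh n d (bits n j ⊕ bits n k)   ≡⟨ cong (walsh n d) e ⟩
  walsh n d (bits n j′ ⊕ bits n k′) ≡⟨ hadamard-conjugate n d j′ k′ ⟨
  _                                ≡⟨ A≡ j′ k′ ⟨
  A j′ k′                          ∎

-- Counting: a duplicate-free list contained in another is no longer

unique⇒lookup-injective : ∀ {A : Set} {xs : List A} → Unique xs →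
  ∀ {i j} → lookup xs i ≡ lookup xs j → i ≡ j
unique⇒lookup-injective (_ ∷ _)    {Fin.zero}  {Fin.zero}  _ = refl
unique⇒lookup-injective (x∉xs ∷ _) {Fin.zero}  {Fin.suc j} e = ⊥-elim (All.lookup x∉xs (∈-lookup j) e)
unique⇒lookup-injective (x∉xs ∷ _) {Fin.suc i} {Fin.zero}  e = ⊥-elim (All.lookup x∉xs (∈-lookup i) (sym e))
unique⇒lookup-injective (_ ∷ u)    {Fin.suc i} {Fin.suc j} e = cong Fin.suc (unique⇒lookup-injective u e)

length-⊆ : ∀ {A : Set} {xs ys : List A} → Unique xs → xs ⊆ ys → length xs ≤ length ys
length-⊆ {xs = xs} {ys} u xs⊆ys = injective⇒≤ position-injective
  where
  position : Fin (length xs) → Fin (length ys)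
  position i = index (xs⊆ys (∈-lookup i))
  position-injective : ∀ {i j} → position i ≡ position j → i ≡ j
  position-injective {i} {j} e = unique⇒lookup-injective u (begin
    lookup xs i             ≡⟨ lookup-index (xs⊆ys (∈-lookup i)) ⟩
    lookup ys (position i)  ≡⟨ cong (lookup ys) e ⟩
    lookup ys (position j)  ≡⟨ lookup-index (xs⊆ys (∈-lookup j)) ⟨
    lookup xs j             ∎)

-- The span of a list in ℤ₂ⁿ: all sums of sublists (with repetitions)

span : ∀ {n} → List (Vec Bool n) → List (Vec Bool n)
span []      = 0ᵥ ∷ []
span (s ∷ S) = span S ++ map (s ⊕_) (span S)

span-length : ∀ {n} (S : List (Vec Bool n)) → length (span S) ≡ 2 ^ length S
span-length []      = refl
span-length (s ∷ S) = begin
  length (span S ++ map (s ⊕_) (span S))      ≡⟨ length-++ (span S) ⟩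
  length (span S) ℕ.+ length (map _ (span S)) ≡⟨ cong (length (span S) ℕ.+_) (length-map _ (span S)) ⟩
  length (span S) ℕ.+ length (span S)         ≡⟨ cong (λ t → t ℕ.+ t) (span-length S) ⟩
  2 ^ length S ℕ.+ 2 ^ length S               ≡⟨ cong (2 ^ length S ℕ.+_) (ℕP.+-identityʳ _) ⟨
  2 ^ length (s ∷ S)                          ∎

0∈span : ∀ {n} (S : List (Vec Bool n)) → 0ᵥ ∈ span S
0∈span []      = here refl
0∈span (s ∷ S) = ∈-++⁺ˡ (0∈span S)

span-∷⁻ : ∀ {n} t (S : List (Vec Bool n)) {x} → x ∈ span (t ∷ S) →
  x ∈ span S ⊎ ∃ λ y → y ∈ span S × x ≡ t ⊕ y
span-∷⁻ t S x∈ with ∈-++⁻ (span S) x∈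
... | inj₁ x∈S = inj₁ x∈S
... | inj₂ x∈tS with ∈-map⁻ (t ⊕_) x∈tS
...   | y , y∈S , x≡ty = inj₂ (y , y∈S , x≡ty)

span-closed : ∀ {n} (S : List (Vec Bool n)) {s x} → s ∈ S → x ∈ span S → s ⊕ x ∈ span S
span-closed (t ∷ S) {s} s∈ x∈ with span-∷⁻ t S x∈ | s∈
... | inj₁ x∈S              | here refl = ∈-++⁺ʳ (span S) (∈-map⁺ (t ⊕_) x∈S)
... | inj₂ (y , y∈S , refl) | here refl = ∈-++⁺ˡ (subst (_∈ span S) (sym (⊕-cancelˡ t y)) y∈S)
... | inj₁ x∈S              | there s∈S = ∈-++⁺ˡ (span-closed S s∈S x∈S)
... | inj₂ (y , y∈S , refl) | there s∈S = ∈-++⁺ʳ (span S)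
      (subst (_∈ map (t ⊕_) (span S)) (⊕-left-comm t s y) (∈-map⁺ (t ⊕_) (span-closed S s∈S y∈S)))

spanning-length : ∀ {n} (S : List (Vec Bool n)) → (∀ x → x ∈ span S) → n ≤ length S
spanning-length {n} S spans = ℕP.≮⇒≥ λ |S|<n →
  ℕP.<⇒≱ (ℕP.^-monoʳ-< 2 (s≤s (s≤s z≤n)) |S|<n) 2ⁿ≤2^|S|
  where
  2ⁿ≤2^|S| : 2 ^ n ≤ 2 ^ length S
  2ⁿ≤2^|S| = subst₂ _≤_ (allVectors-length n) (span-length S)
    (length-⊆ (allVectors-unique n) (λ {x} _ → spans x))

-- Subgraphs of the cube

cubeNeighbours : ∀ {n} → Vertex n → List (Vertex n)
cubeNeighbours []      = []
cubeNeighbours (b ∷ u) = (not b ∷ u) ∷ map (b ∷_) (cubeNeighbours u)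

cubeNeighbours-length : ∀ {n} (u : Vertex n) → length (cubeNeighbours u) ≡ n
cubeNeighbours-length []      = refl
cubeNeighbours-length (b ∷ u) = cong suc (trans (length-map _ (cubeNeighbours u)) (cubeNeighbours-length u))

Adj1⇒∈cubeNeighbours : ∀ {n} {u w : Vertex n} → Adj1 u w → w ∈ cubeNeighbours u
Adj1⇒∈cubeNeighbours (here b≢c) = here (cong (_∷ _) (¬-not (b≢c ∘ sym)))
Adj1⇒∈cubeNeighbours (there a)  = there (∈-map⁺ _ (Adj1⇒∈cubeNeighbours a))

-- in a subgraph of Qₙ, an endpoint u of a missing cube edge uv has fewer
-- than n neighbours: they and v are distinct cube neighbours of u
degree-bound : ∀ {n} {G : Graph n} → IsSubgraphOfCube G → ∀ {u v} → Adj1 u v → G u v ≡ false →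
  (N : List (Vertex n)) → Unique N → All (Edge G u) N → length N < n
degree-bound {n} {G} sub {u} {v} uv Guv≡false N N-unique N-edges =
  subst (suc (length N) ≤_) (cubeNeighbours-length u) (length-⊆ (v∉N ∷ N-unique) v∷N⊆)
  where
  v∉N : All (λ w → ¬ v ≡ w) N
  v∉N = All.map (λ { Guw refl → true≢false (trans (sym Guw) Guv≡false) }) N-edges
    where
    true≢false : ¬ true ≡ false
    true≢false ()
  v∷N⊆ : v ∷ N ⊆ cubeNeighbours u
  v∷N⊆ (here refl) = Adj1⇒∈cubeNeighbours uv
  v∷N⊆ (there w∈N) = Adj1⇒∈cubeNeighbours (sub u _ (All.lookup N-edges w∈N))

-- Translation-invariant graphs on ℤ₂ⁿ (Cayley graphs of ℤ₂ⁿ)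

module TranslationInvariant {n} (G : Graph n)
  (τ : Vec Bool n → Vertex n) (β : Vertex n → Vec Bool n)
  (τ∘β : ∀ w → τ (β w) ≡ w) (β∘τ : ∀ x → β (τ x) ≡ x)
  (invariant : ∀ x y → G (τ x) (τ y) ≡ G (τ 0ᵥ) (τ (x ⊕ y))) where

  S : List (Vec Bool n)
  S = filter (λ s → G (τ 0ᵥ) (τ s) Bool.≟ true) (allVectors n)

  edge⇒∈S : ∀ {x y} → Edge G (τ x) (τ y) → x ⊕ y ∈ S
  edge⇒∈S {x} {y} e = ∈-filter⁺ _ (∈-allVectors (x ⊕ y)) (trans (sym (invariant x y)) e)

  ∈S⇒edge : ∀ {x s} → s ∈ S → Edge G (τ x) (τ (x ⊕ s))
  ∈S⇒edge {x} {s} s∈S = trans (invariant x (x ⊕ s))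
    (trans (cong (G (τ 0ᵥ) ∘ τ) (⊕-cancelˡ x s)) (proj₂ (∈-filter⁻ _ {xs = allVectors n} s∈S)))

  -- walking along an edge adds an element of S to the label
  reachable⇒span : ∀ {a b} → Reachable G a b → β a ∈ span S → β b ∈ span S
  reachable⇒span refl                  a∈ = a∈
  reachable⇒span {a} (step {v = c} e r) a∈ = reachable⇒span r
    (subst (_∈ span S) (⊕-cancelʳ (β a) (β c)) (span-closed S (edge⇒∈S e′) a∈))
    where
    e′ : Edge G (τ (β a)) (τ (β c))
    e′ = subst₂ (λ p q → Edge G p q) (sym (τ∘β a)) (sym (τ∘β c)) e

  connected⇒spanning : Connected G → ∀ x → x ∈ span S
  connected⇒spanning conn x = subst (_∈ span S) (β∘τ x)
    (reachable⇒span (conn (τ 0ᵥ) (τ x)) (subst (_∈ span S) (sym (β∘τ 0ᵥ)) (0∈span S)))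

  neighbours : Vertex n → List (Vertex n)
  neighbours u = map (λ s → τ (β u ⊕ s)) S

  neighbours-edges : ∀ u → All (Edge G u) (neighbours u)
  neighbours-edges u = All.tabulate λ w∈ → translate-edge (∈-map⁻ _ w∈)
    where
    translate-edge : ∀ {w} → ∃ (λ s → s ∈ S × w ≡ τ (β u ⊕ s)) → Edge G u w
    translate-edge (s , s∈S , refl) = subst (λ p → Edge G p (τ (β u ⊕ s))) (τ∘β u) (∈S⇒edge s∈S)

  neighbours-unique : ∀ u → Unique (neighbours u)
  neighbours-unique u = Unique.map⁺ translate-injective
    (Unique.filter⁺ _ (allVectors-unique n))
    where
    translate-injective : ∀ {s t} → τ (β u ⊕ s) ≡ τ (β u ⊕ t) → s ≡ t
    translate-injective {s} {t} e = ⊕-injectiveˡ (β u)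
      (trans (sym (β∘τ (β u ⊕ s))) (trans (cong β e) (β∘τ (β u ⊕ t))))

module Labelling {n} (σ : Fin (2 ^ n) ⤖ Vertex n) where
  open Bijection σ using (to; to⁻; injective; surjection)

  τ : Vec Bool n → Vertex n
  τ x = to (unbits n x)

  β : Vertex n → Vec Bool n
  β w = bits n (to⁻ w)

  τ∘β : ∀ w → τ (β w) ≡ w
  τ∘β w = trans (cong to (unbits-bits n (to⁻ w))) (Surjection.to∘to⁻ surjection w)

  β∘τ : ∀ x → β (τ x) ≡ x
  β∘τ x = trans (cong (bits n) (injective (Surjection.to∘to⁻ surjection (τ x)))) (bits-unbits n x)

indicator-injective : ∀ a b → (if a then 1ℚ else 0ℚ) ≡ (if b then 1ℚ else 0ℚ) → a ≡ b
indicator-injective false false _ = refl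
indicator-injective true  true  _ = refl
indicator-injective false true  ()
indicator-injective true  false ()

diagonalizable⇒invariant-graph : ∀ {n} (G : Graph n) (σ : Fin (2 ^ n) ⤖ Vertex n) →
  HadamardDiagonalizable n (adjMatrix G σ) →
  let open Labelling σ in ∀ x y → G (τ x) (τ y) ≡ G (τ 0ᵥ) (τ (x ⊕ y))
diagonalizable⇒invariant-graph {n} G σ diagonalizable x y = indicator-injective _ _
  (diagonalizable⇒translation-invariant n (adjMatrix G σ) diagonalizable
    (unbits n x) (unbits n y) (unbits n 0ᵥ) (unbits n (x ⊕ y)) labels)
  where
  labels : bits n (unbits n x) ⊕ bits n (unbits n y) ≡ bits n (unbits n 0ᵥ) ⊕ bits n (unbits n (x ⊕ y))
  labels = begin
    bits n (unbits n x) ⊕ bits n (unbits n y)  ≡⟨ cong₂ _⊕_ (bits-unbits n x) (bits-unbits n y) ⟩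
    x ⊕ y                                      ≡⟨ ⊕-identityˡ (x ⊕ y) ⟨
    0ᵥ ⊕ (x ⊕ y)                               ≡⟨ cong₂ _⊕_ (bits-unbits n 0ᵥ) (bits-unbits n (x ⊕ y)) ⟨
    bits n (unbits n 0ᵥ) ⊕ bits n (unbits n (x ⊕ y))  ∎

proposition1 : (n : ℕ) → n ≥ 1 → (G : Graph n) → IsSimple G → IsSubgraphOfCube G → MissesCubeEdge G → Connected G
    → (σ : Fin (2 ^ n) ⤖ Vertex n) → ¬ HadamardDiagonalizable n (adjMatrix G σ)
proposition1 n _ G _ sub (u , v , uv , Guv≡false) conn σ diagonalizable =
  ℕP.<⇒≱ |S|<n n≤|S|
  where
  open Labelling σ
  open TranslationInvariant G τ β τ∘β β∘τ (diagonalizable⇒invariant-graph G σ diagonalizable)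

  -- u has |S| distinct neighbours, and fewer than n
  |S|<n : length S < n
  |S|<n = subst (_< n) (length-map _ S)
    (degree-bound sub uv Guv≡false (neighbours u) (neighbours-unique u) (neighbours-edges u))

  -- S spans ℤ₂ⁿ since G is connected
  n≤|S| : n ≤ length S
  n≤|S| = spanning-length S (connected⇒spanning conn)
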